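{- There exists a deterministic query algorithm which, given $x\in\Sigma^M$ and an index $j\in[m]$, makes $\widetilde O(n+m)$ queries to $x$ and accepts if and only if $g_{n,m}(x)=1$ and $j$ belongs to the set $G$ (i.e., column $j$ is good).
   Context: Let $n,m$ be positive integers, $m$ even, $M=[n]\times[m]$ a grid of cells $(i,j)$ (row $i$, column $j$), $\widetilde M = M\cup\{\bot\}$ (pointers to cells, $\bot$ null). Let $T$ be the rooted binary tree with $m$ leaves and $m-1$ internal nodes (each with a left and right child): if $m=2^k$, the complete binary tree of depth $k$; if $2^k<m<2^{k+1}$, the complete binary tree with $2^k$ leaves with two children attached to each of its $m-2^k$ leftmost leaves. Leaves labelled $1,\dots,m$ left to right; $T(j)$ is the left/right path from the root to leaf $j$. Alphabet $\Sigma=\{0,1\}\times\widetilde M\times\widetilde M\times\widetilde M$, components $\mathrm{val},\mathrm{lpoint},\mathrm{rpoint},\mathrm{bpoint}$. $g_{n,m}\colon\Sigma^M\to\{0,1\}$: $g_{n,m}(x)=1$ iff (1) exactly one column $b$ has $\mathrm{val}(x_{i,b})=1$ for all $i$; (2) column $b$ has a unique cell $a$ with $x_a\ne(1,\bot,\bot,\bot)$; (3) for each $j'\ne b$, following $\mathrm{lpoint}/\mathrm{rpoint}$ from $a$ according to $T(j')$ meets no $\bot$ and ends at a cell $\ell_{j'}$ in column $j'$ with $\mathrm{val}(x_{\ell_{j'}})=0$; (4') the set $G=\{j'\in[m]\setminus\{b\}:\mathrm{bpoint}(x_{\ell_{j'}})=a\}$ has exactly $m/2$ elements. For a positive input, a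 column is called good if it lies in $G$; a negative input has no good columns. Each query returns an element $x_{i,j}\in\Sigma$. $\widetilde O$ hides factors polylogarithmic in $n,m$. -}

module Defs where

open import Data.Bool using (Bool; true; false)
open import Data.Nat using (ℕ; zero; suc; _+_; _*_; _∸_; _^_; _≤_)
open import Data.Nat.Logarithm using (⌊log₂_⌋)
open import Data.Fin using (Fin; toℕ)
open import Data.Maybe using (Maybe; just; nothing; _>>=_)
open import Data.List using (List; []; _∷_; _++_; map)
open import Data.Product using (Σ; _×_; _,_; proj₁; proj₂; ∃)
open import Relation.Binary.PropositionalEquality using (_≡_; _≢_)
open import Function.Definitions using (Injective)

-- The grid M = [n] × [m] (0-based: row i : Fin n, column j : Fin m),
-- pointers M̃ = Maybe M (nothing = ⊥), alphabet Σ.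

Cell : ℕ → ℕ → Set
Cell n m = Fin n × Fin m

row : ∀ {n m} → Cell n m → Fin n
row = proj₁

col : ∀ {n m} → Cell n m → Fin m
col = proj₂

Ptr : ℕ → ℕ → Set
Ptr n m = Maybe (Cell n m)

Sym : ℕ → ℕ → Set
Sym n m = Bool × Ptr n m × Ptr n m × Ptr n m

val : ∀ {n m} → Sym n m → Bool
val (v , _ , _ , _) = v

lpoint rpoint bpoint : ∀ {n m} → Sym n m → Ptr n m
lpoint (_ , l , _ , _) = l
rpoint (_ , _ , r , _) = r
bpoint (_ , _ , _ , p) = p

blank : ∀ {n m} → Sym n m
blank = (true , nothing , nothing , nothing)

Input : ℕ → ℕ → Set
Input n m = Cell n m → Sym n m

data Dir : Set where
  L R : Dir

data Tree : Set where
  leaf : Tree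
  node : Tree → Tree → Tree

complete : ℕ → Tree
complete zero    = leaf
complete (suc k) = node (complete k) (complete k)

expand : ℕ → Tree → Tree × ℕ
expand zero    leaf       = leaf , zero
expand (suc r) leaf       = node leaf leaf , r
expand r       (node a b) with expand r a
... | a' , r₁ with expand r₁ b
... | b' , r₂ = node a' b' , r₂

-- T for m leaves, 2^k ≤ m < 2^(k+1), k = ⌊log₂ m⌋
T : ℕ → Tree
T m = proj₁ (expand (m ∸ 2 ^ ⌊log₂ m ⌋) (complete ⌊log₂ m ⌋))

leafPaths : Tree → List (List Dir)
leafPaths leaf       = [] ∷ []
leafPaths (node a b) = map (L ∷_) (leafPaths a) ++ map (R ∷_) (leafPaths b)

nth : {A : Set} → List A → ℕ → Maybe A
nth []       _       = nothing
nth (x ∷ xs) zero    = just x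
nth (x ∷ xs) (suc i) = nth xs i

-- T(j): the path from the root of T to leaf j (leaf labelled j+1 in 1-based terms)
path : (m : ℕ) → Fin m → Maybe (List Dir)
path m j = nth (leafPaths (T m)) (toℕ j)

follow : ∀ {n m} → Input n m → Cell n m → List Dir → Maybe (Cell n m)
follow x c []      = just c
follow x c (L ∷ p) = lpoint (x c) >>= λ c' → follow x c' p
follow x c (R ∷ p) = rpoint (x c) >>= λ c' → follow x c' p

endpoint : ∀ {n m} → Input n m → Cell n m → Fin m → Maybe (Cell n m)
endpoint {m = m} x a j' = path m j' >>= follow x a

AllOnes : ∀ {n m} → Input n m → Fin m → Set
AllOnes x b = ∀ i → val (x (i , b)) ≡ true

Cond1 : ∀ {n m} → Input n m → Fin m → Set
Cond1 x b = AllOnes x b × (∀ b' → AllOnes x b' → b' ≡ b)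

Cond2 : ∀ {n m} → Input n m → Fin m → Cell n m → Set
Cond2 x b a = (col a ≡ b) × (x a ≢ blank)
            × (∀ a' → col a' ≡ b → x a' ≢ blank → a' ≡ a)

Cond3 : ∀ {n m} → Input n m → Fin m → Cell n m → Set
Cond3 x b a = ∀ j' → j' ≢ b →
  Σ _ λ ℓ → (endpoint x a j' ≡ just ℓ) × (col ℓ ≡ j') × (val (x ℓ) ≡ false)

InG : ∀ {n m} → Input n m → Fin m → Cell n m → Fin m → Set
InG x b a j' = (j' ≢ b) ×
  Σ _ λ ℓ → (endpoint x a j' ≡ just ℓ) × (bpoint (x ℓ) ≡ just a)

-- a predicate P on Fin m has exactly k elements: it is the image of an
-- injection Fin k → Fin m
HasCard : ∀ {m} → (Fin m → Set) → ℕ → Set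
HasCard {m} P k = Σ (Fin k → Fin m) λ f →
  Injective _≡_ _≡_ f × (∀ j → P j → ∃ λ i → f i ≡ j) × (∀ i → P (f i))

-- (4') |G| = m/2  (m even; m/2 written as h with m ≡ 2 * h)
Cond4 : ∀ {n m} → Input n m → Fin m → Cell n m → ℕ → Set
Cond4 x b a h = HasCard (InG x b a) h

PositiveGood : ∀ {n m} → (h : ℕ) → Input n m → Fin m → Set
PositiveGood {n} {m} h x j = Σ (Fin m) λ b → Σ (Cell n m) λ a →
  Cond1 x b × Cond2 x b a × Cond3 x b a × Cond4 x b a h × InG x b a j

-- Deterministic query algorithms = decision trees querying positions of
-- type Q and receiving answers of type A; leaves accept/reject.

data DTree (Q A : Set) : Set where
  output : Bool → DTree Q A
  query  : Q → (A → DTree Q A) → DTree Q A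

run : ∀ {Q A} → DTree Q A → (Q → A) → Bool
run (output b)  x = b
run (query q k) x = run (k (x q)) x

cost : ∀ {Q A} → DTree Q A → (Q → A) → ℕ
cost (output b)  x = zero
cost (query q k) x = suc (cost (k (x q)) x)

module Submission where

-- The algorithm
-- exploits that a good column j points back at the anchor: some row i has
-- bpoint (x (i , j)) = a.  It therefore
--   * reads the n back-pointers of column j (n queries),
--   * runs a king-of-the-hill tournament over these candidates with a
--     comparison that the true anchor wins against every other cell
--     (one path of length O(log m) per comparison), and
--   * verifies the surviving candidate by checking (1)-(4') and j ∈ G
--     directly (O(n + m log m) queries).

open import Defs
open import Data.Bool using (Bool; true; false; not; _∧_; _∨_; if_then_else_)
import Data.Bool.Properties as Bool
open import Data.Nat using (ℕ; zero; suc; _+_; _*_; _∸_; _^_; _≤_; _⊔_; z≤n; s≤s; NonZero)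
open import Data.Nat.Properties
  using (≤-refl; ≤-trans; ≤-reflexive; ≤-antisym; +-assoc; +-identityʳ; +-mono-≤;
         m≤m+n; m≤n+m; m≤m⊔n; m≤n⊔m; ⊔-lub)
  renaming (_≟_ to _≟ℕ_)
open import Data.Nat.Logarithm using (⌊log₂_⌋; ⌊log₂⌋-mono-≤)
open import Data.Nat.Tactic.RingSolver using (solve-∀)
open import Data.Fin using (Fin; zero; suc)
open import Data.Fin.Properties using (suc-injective; injective⇒≤) renaming (_≟_ to _≟ᶠ_)
open import Data.Maybe using (Maybe; just; nothing; maybe′; _>>=_)
open import Data.Maybe.Properties using (just-injective)
import Data.Maybe.Properties as Maybe
import Data.Product.Properties as Product
open import Data.List using (List; []; _∷_; map; length)
open import Data.List.Relation.Unary.All as All using (All; []; _∷_)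
open import Data.List.Relation.Unary.All.Properties using (++⁺; map⁺)
open import Data.Product using (Σ; _×_; ∃; _,_; proj₁; proj₂)
open import Data.Sum using (_⊎_; inj₁; inj₂)
open import Data.Empty using (⊥-elim)
open import Relation.Nullary using (Dec; yes; no; does; proof; ¬_; ¬?; _×-dec_; _⊎-dec_)
open import Relation.Nullary.Reflects using (Reflects; ofʸ; ofⁿ; det; _×-reflects_; _→-reflects_)
open import Relation.Binary using (DecidableEquality)
open import Relation.Binary.PropositionalEquality using (_≡_; _≢_; refl; sym; trans; cong; subst)
open import Function.Definitions using (Injective)

reflects-map : ∀ {B C : Set} {b} → (B → C) → (C → B) → Reflects B b → Reflects C b
reflects-map f g (ofʸ p)  = ofʸ (f p)
reflects-map f g (ofⁿ ¬p) = ofⁿ (λ c → ¬p (g c))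

reflects-sound : ∀ {B : Set} {b} → Reflects B b → b ≡ true → B
reflects-sound (ofʸ p) refl = p

hasCard-≤ : ∀ {k h h′} {P : Fin k → Set} → HasCard P h → HasCard P h′ → h ≤ h′
hasCard-≤ {h = h} {h′} (f , f-inj , _ , f-mem) (g , _ , g-onto , _) = injective⇒≤ embed-inj
  where
  embed : Fin h → Fin h′
  embed i = proj₁ (g-onto (f i) (f-mem i))
  embed-inj : Injective _≡_ _≡_ embed
  embed-inj {i} {i′} e = f-inj (trans (sym (proj₂ (g-onto (f i) (f-mem i))))
                                (trans (cong g e) (proj₂ (g-onto (f i′) (f-mem i′)))))

hasCard-unique : ∀ {k h h′} {P : Fin k → Set} → HasCard P h → HasCard P h′ → h ≡ h′
hasCard-unique c c′ = ≤-antisym (hasCard-≤ c c′) (hasCard-≤ c′ c)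

hasCard-cons-yes : ∀ {k h} {P : Fin (suc k) → Set} →
  P zero → HasCard (λ i → P (suc i)) h → HasCard P (suc h)
hasCard-cons-yes {k} {h} {P} p (f , f-inj , f-onto , f-mem) = f′ , f′-inj , f′-onto , f′-mem
  where
  f′ : Fin (suc h) → Fin (suc k)
  f′ zero    = zero
  f′ (suc i) = suc (f i)
  f′-inj : Injective _≡_ _≡_ f′
  f′-inj {zero}  {zero}  _ = refl
  f′-inj {suc i} {suc j} e = cong suc (f-inj (suc-injective e))
  f′-onto : ∀ j → P j → ∃ λ i → f′ i ≡ j
  f′-onto zero    _  = zero , refl
  f′-onto (suc j) pj = suc (proj₁ (f-onto j pj)) , cong suc (proj₂ (f-onto j pj))
  f′-mem : ∀ i → P (f′ i)
  f′-mem zero    = p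
  f′-mem (suc i) = f-mem i

hasCard-cons-no : ∀ {k h} {P : Fin (suc k) → Set} →
  ¬ P zero → HasCard (λ i → P (suc i)) h → HasCard P h
hasCard-cons-no {P = P} ¬p (f , f-inj , f-onto , f-mem) =
  (λ i → suc (f i)) , (λ e → f-inj (suc-injective e)) , onto , f-mem
  where
  onto : ∀ j → P j → ∃ λ i → suc (f i) ≡ j
  onto zero    pz = ⊥-elim (¬p pz)
  onto (suc j) pj = proj₁ (f-onto j pj) , cong suc (proj₂ (f-onto j pj))

bump : Bool → ℕ → ℕ
bump b c = if b then suc c else c

count : (k : ℕ) → (Fin k → Bool) → ℕ
count zero    g = 0
count (suc k) g = bump (g zero) (count k (λ i → g (suc i)))

hasCard-count : ∀ {k} {P : Fin k → Set} (g : Fin k → Bool) →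
  (∀ i → Reflects (P i) (g i)) → HasCard P (count k g)
hasCard-count {zero} g r = (λ ()) , (λ { {()} }) , (λ ()) , (λ ())
hasCard-count {suc k} g r with g zero | r zero
... | true  | ofʸ p  = hasCard-cons-yes p  (hasCard-count (λ i → g (suc i)) (λ i → r (suc i)))
... | false | ofⁿ ¬p = hasCard-cons-no  ¬p (hasCard-count (λ i → g (suc i)) (λ i → r (suc i)))

count-reflects : ∀ {k} {P : Fin k → Set} (g : Fin k → Bool) h →
  (∀ i → Reflects (P i) (g i)) → Reflects (HasCard P h) (does (count k g ≟ℕ h))
count-reflects {P = P} g h r = reflects-map
  (λ e → subst (HasCard P) e (hasCard-count g r))
  (hasCard-unique (hasCard-count g r))
  (proof (count _ g ≟ℕ h))

depth : Tree → ℕ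
depth leaf       = 0
depth (node a b) = suc (depth a ⊔ depth b)

complete-depth : ∀ k → depth (complete k) ≤ k
complete-depth zero    = z≤n
complete-depth (suc k) = s≤s (⊔-lub (complete-depth k) (complete-depth k))

expand-node : ∀ r a b → let (a′ , r₁) = expand r a in
  proj₁ (expand r (node a b)) ≡ node a′ (proj₁ (expand r₁ b))
expand-node zero    a b = refl
expand-node (suc r) a b = refl

expand-depth : ∀ r t → depth (proj₁ (expand r t)) ≤ suc (depth t)
expand-depth zero    leaf       = z≤n
expand-depth (suc r) leaf       = s≤s z≤n
expand-depth r       (node a b) rewrite expand-node r a b =
  s≤s (⊔-lub (≤-trans (expand-depth r a) (s≤s (m≤m⊔n (depth a) (depth b))))
             (≤-trans (expand-depth (proj₂ (expand r a)) b) (s≤s (m≤n⊔m (depth a) (depth b)))))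

ShortPath : ℕ → List Dir → Set
ShortPath d p = length p ≤ d

leafPaths-short : ∀ t → All (ShortPath (depth t)) (leafPaths t)
leafPaths-short leaf       = z≤n ∷ []
leafPaths-short (node a b) =
  ++⁺ (extend L (m≤m⊔n (depth a) (depth b)) (leafPaths-short a))
      (extend R (m≤n⊔m (depth a) (depth b)) (leafPaths-short b))
  where
  extend : ∀ {d e} c {ps} → d ≤ e → All (ShortPath d) ps → All (ShortPath (suc e)) (map (c ∷_) ps)
  extend c d≤e short = map⁺ (All.map (λ l → s≤s (≤-trans l d≤e)) short)

nth-All : ∀ {A : Set} {P : A → Set} {xs i a} → All P xs → nth xs i ≡ just a → P a
nth-All {xs = _ ∷ _} {zero}  (px ∷ _)  refl = px
nth-All {xs = _ ∷ _} {suc i} (_ ∷ pxs) e    = nth-All pxs e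

path-length : ∀ m (j : Fin m) {p} → path m j ≡ just p → length p ≤ suc ⌊log₂ m ⌋
path-length m j e = ≤-trans (nth-All (leafPaths-short (T m)) e)
  (≤-trans (expand-depth (m ∸ 2 ^ ⌊log₂ m ⌋) (complete ⌊log₂ m ⌋))
           (s≤s (complete-depth ⌊log₂ m ⌋)))

data Prog (Q A X : Set) : Set where
  ret : X → Prog Q A X
  ask : Q → (A → Prog Q A X) → Prog Q A X

module _ {Q A : Set} where

  infixl 1 _>>=ᴾ_
  infixr 6 _&&ᴾ_
  infixr 5 _⇒ᴾ_

  _>>=ᴾ_ : ∀ {X Y} → Prog Q A X → (X → Prog Q A Y) → Prog Q A Y
  ret r   >>=ᴾ k = k r
  ask q f >>=ᴾ k = ask q (λ a → f a >>=ᴾ k)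

  mapᴾ : ∀ {X Y} → (X → Y) → Prog Q A X → Prog Q A Y
  mapᴾ f p = p >>=ᴾ λ r → ret (f r)

  zipWithᴾ : ∀ {X Y Z} → (X → Y → Z) → Prog Q A X → Prog Q A Y → Prog Q A Z
  zipWithᴾ f p q = p >>=ᴾ λ r → mapᴾ (f r) q

  decideᴾ : {B : Set} → Dec B → Prog Q A Bool
  decideᴾ d = ret (does d)

  checkᴾ : {B : A → Set} → Q → ((a : A) → Dec (B a)) → Prog Q A Bool
  checkᴾ q d = ask q λ a → ret (does (d a))

  _&&ᴾ_ _⇒ᴾ_ : Prog Q A Bool → Prog Q A Bool → Prog Q A Bool
  _&&ᴾ_ = zipWithᴾ _∧_
  _⇒ᴾ_  = zipWithᴾ λ b c → not b ∨ c

  whenJustᴾ : ∀ {X} → Prog Q A (Maybe X) → (X → Prog Q A Bool) → Prog Q A Bool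
  whenJustᴾ p test = p >>=ᴾ maybe′ test (ret false)

  allᴾ : (k : ℕ) → (Fin k → Prog Q A Bool) → Prog Q A Bool
  allᴾ zero    f = ret true
  allᴾ (suc k) f = f zero &&ᴾ allᴾ k (λ i → f (suc i))

  countᴾ : (k : ℕ) → (Fin k → Prog Q A Bool) → Prog Q A ℕ
  countᴾ zero    f = ret 0
  countᴾ (suc k) f = zipWithᴾ bump (f zero) (countᴾ k (λ i → f (suc i)))

  countIsᴾ : ℕ → (k : ℕ) → (Fin k → Prog Q A Bool) → Prog Q A Bool
  countIsᴾ h k f = mapᴾ (λ c → does (c ≟ℕ h)) (countᴾ k f)

  playᴾ : ∀ {X} → (X → X → Prog Q A X) → Maybe X → Maybe X → Prog Q A (Maybe X)
  playᴾ cmp nothing  d        = ret d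
  playᴾ cmp (just c) nothing  = ret (just c)
  playᴾ cmp (just c) (just d) = mapᴾ just (cmp c d)

  tournamentᴾ : ∀ {X} → (X → X → Prog Q A X) → Maybe X →
    (k : ℕ) → (Fin k → Prog Q A (Maybe X)) → Prog Q A (Maybe X)
  tournamentᴾ cmp champ zero    f = ret champ
  tournamentᴾ cmp champ (suc k) f =
    f zero >>=ᴾ λ d → playᴾ cmp champ d >>=ᴾ λ champ′ → tournamentᴾ cmp champ′ k (λ i → f (suc i))

  toDTree : Prog Q A Bool → DTree Q A
  toDTree (ret b)   = output b
  toDTree (ask q f) = query q (λ a → toDTree (f a))

  module Semantics (x : Q → A) where

    runᴾ : ∀ {X} → Prog Q A X → X
    runᴾ (ret r)   = r
    runᴾ (ask q f) = runᴾ (f (x q))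

    costᴾ : ∀ {X} → Prog Q A X → ℕ
    costᴾ (ret r)   = 0
    costᴾ (ask q f) = suc (costᴾ (f (x q)))

    run-bind : ∀ {X Y} (p : Prog Q A X) (k : X → Prog Q A Y) → runᴾ (p >>=ᴾ k) ≡ runᴾ (k (runᴾ p))
    run-bind (ret r)   k = refl
    run-bind (ask q f) k = run-bind (f (x q)) k

    cost-bind : ∀ {X Y} (p : Prog Q A X) (k : X → Prog Q A Y) →
      costᴾ (p >>=ᴾ k) ≡ costᴾ p + costᴾ (k (runᴾ p))
    cost-bind (ret r)   k = refl
    cost-bind (ask q f) k = cong suc (cost-bind (f (x q)) k)

    cost-bind-≤ : ∀ {X Y B₁ B₂} (p : Prog Q A X) (k : X → Prog Q A Y) →
      costᴾ p ≤ B₁ → (∀ r → costᴾ (k r) ≤ B₂) → costᴾ (p >>=ᴾ k) ≤ B₁ + B₂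
    cost-bind-≤ p k c₁ c₂ = ≤-trans (≤-reflexive (cost-bind p k)) (+-mono-≤ c₁ (c₂ _))

    run-map : ∀ {X Y} (f : X → Y) (p : Prog Q A X) → runᴾ (mapᴾ f p) ≡ f (runᴾ p)
    run-map f p = run-bind p _

    cost-map : ∀ {X Y} (f : X → Y) (p : Prog Q A X) → costᴾ (mapᴾ f p) ≡ costᴾ p
    cost-map f p = trans (cost-bind p _) (+-identityʳ (costᴾ p))

    run-zipWith : ∀ {X Y Z} (f : X → Y → Z) p q → runᴾ (zipWithᴾ f p q) ≡ f (runᴾ p) (runᴾ q)
    run-zipWith f p q = trans (run-bind p _) (run-map _ q)

    cost-zipWith-≤ : ∀ {X Y Z B₁ B₂} (f : X → Y → Z) p q →
      costᴾ p ≤ B₁ → costᴾ q ≤ B₂ → costᴾ (zipWithᴾ f p q) ≤ B₁ + B₂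
    cost-zipWith-≤ f p q c₁ c₂ = cost-bind-≤ p _ c₁ λ r → ≤-trans (≤-reflexive (cost-map (f r) q)) c₂

    Decides : Prog Q A Bool → Set → Set
    Decides p B = Reflects B (runᴾ p)

    &&-decides : ∀ {B C} p q → Decides p B → Decides q C → Decides (p &&ᴾ q) (B × C)
    &&-decides p q dp dq = subst (Reflects _) (sym (run-zipWith _∧_ p q)) (dp ×-reflects dq)

    ⇒-decides : ∀ {B C} p q → Decides p B → Decides q C → Decides (p ⇒ᴾ q) (B → C)
    ⇒-decides p q dp dq = subst (Reflects _) (sym (run-zipWith _ p q)) (dp →-reflects dq)

    whenJust-decides : ∀ {X} {B : X → Set} (p : Prog Q A (Maybe X)) (test : X → Prog Q A Bool) →
      (∀ r → Decides (test r) (B r)) → Decides (whenJustᴾ p test) (Σ X λ r → runᴾ p ≡ just r × B r)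
    whenJust-decides {X} {B} p test dtest =
      subst (Reflects _) (sym (run-bind p _)) (on (runᴾ p))
      where
      on : ∀ mr → Reflects (Σ X λ r → mr ≡ just r × B r) (runᴾ (maybe′ test (ret false) mr))
      on nothing  = ofⁿ λ { (_ , () , _) }
      on (just r) = reflects-map (λ b → r , refl , b) (λ { (_ , refl , b) → b }) (dtest r)

    all-decides : ∀ {k} {B : Fin k → Set} (f : Fin k → Prog Q A Bool) →
      (∀ i → Decides (f i) (B i)) → Decides (allᴾ k f) (∀ i → B i)
    all-decides {zero}  f df = ofʸ λ ()
    all-decides {suc k} f df = reflects-map
      (λ { (b₀ , bs) zero → b₀ ; (b₀ , bs) (suc i) → bs i })
      (λ bs → bs zero , λ i → bs (suc i))
      (&&-decides (f zero) (allᴾ k (λ i → f (suc i)))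
        (df zero) (all-decides (λ i → f (suc i)) (λ i → df (suc i))))

    run-count : ∀ k (f : Fin k → Prog Q A Bool) → runᴾ (countᴾ k f) ≡ count k (λ i → runᴾ (f i))
    run-count zero    f = refl
    run-count (suc k) f = trans (run-zipWith bump (f zero) (countᴾ k (λ i → f (suc i))))
      (cong (bump (runᴾ (f zero))) (run-count k (λ i → f (suc i))))

    countIs-decides : ∀ {k} {B : Fin k → Set} h (f : Fin k → Prog Q A Bool) →
      (∀ i → Decides (f i) (B i)) → Decides (countIsᴾ h k f) (HasCard B h)
    countIs-decides {k} h f df = subst (Reflects _)
      (sym (trans (run-map _ (countᴾ k f)) (cong (λ c → does (c ≟ℕ h)) (run-count k f))))
      (count-reflects _ h df)

    cost-all-≤ : ∀ {k B} (f : Fin k → Prog Q A Bool) → (∀ i → costᴾ (f i) ≤ B) → costᴾ (allᴾ k f) ≤ k * B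
    cost-all-≤ {zero}  f c = z≤n
    cost-all-≤ {suc k} f c = cost-zipWith-≤ _∧_ (f zero) (allᴾ k (λ i → f (suc i)))
      (c zero) (cost-all-≤ (λ i → f (suc i)) (λ i → c (suc i)))

    cost-count-≤ : ∀ {k B} (f : Fin k → Prog Q A Bool) → (∀ i → costᴾ (f i) ≤ B) → costᴾ (countᴾ k f) ≤ k * B
    cost-count-≤ {zero}  f c = z≤n
    cost-count-≤ {suc k} f c = cost-zipWith-≤ bump (f zero) (countᴾ k (λ i → f (suc i)))
      (c zero) (cost-count-≤ (λ i → f (suc i)) (λ i → c (suc i)))

    cost-whenJust-≤ : ∀ {X B₁ B₂} (p : Prog Q A (Maybe X)) test →
      costᴾ p ≤ B₁ → (∀ r → costᴾ (test r) ≤ B₂) → costᴾ (whenJustᴾ p test) ≤ B₁ + B₂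
    cost-whenJust-≤ p test c₁ c₂ = cost-bind-≤ p _ c₁ λ { nothing → z≤n ; (just r) → c₂ r }

    Dominant : ∀ {X} → (X → X → Prog Q A X) → X → Set
    Dominant cmp a = (∀ d → runᴾ (cmp a d) ≡ a) × (∀ c → runᴾ (cmp c a) ≡ a)

    play-dominant : ∀ {X} (cmp : X → X → Prog Q A X) {a} → Dominant cmp a →
      ∀ champ d → champ ≡ just a ⊎ d ≡ just a → runᴾ (playᴾ cmp champ d) ≡ just a
    play-dominant cmp dom nothing  d        (inj₂ e)    = e
    play-dominant cmp dom (just c) nothing  (inj₁ e)    = e
    play-dominant cmp dom (just a) (just d) (inj₁ refl) =
      trans (run-map just (cmp a d)) (cong just (proj₁ dom d))
    play-dominant cmp dom (just c) (just a) (inj₂ refl) =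
      trans (run-map just (cmp c a)) (cong just (proj₂ dom c))

    run-tournament-step : ∀ {X} (cmp : X → X → Prog Q A X) champ k f →
      runᴾ (tournamentᴾ cmp champ (suc k) f) ≡
      runᴾ (tournamentᴾ cmp (runᴾ (playᴾ cmp champ (runᴾ (f zero)))) k (λ i → f (suc i)))
    run-tournament-step cmp champ k f = trans (run-bind (f zero) _) (run-bind (playᴾ cmp champ _) _)

    tournament-dominant : ∀ {X} (cmp : X → X → Prog Q A X) {a} → Dominant cmp a →
      ∀ champ k f → (champ ≡ just a ⊎ ∃ λ i → runᴾ (f i) ≡ just a) →
      runᴾ (tournamentᴾ cmp champ k f) ≡ just a
    tournament-dominant cmp dom champ zero    f (inj₁ e) = e
    tournament-dominant {X} cmp {a} dom champ (suc k) f present =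
      trans (run-tournament-step cmp champ k f)
            (tournament-dominant cmp dom champ′ k (λ i → f (suc i)) (after present))
      where
      champ′ : Maybe X
      champ′ = runᴾ (playᴾ cmp champ (runᴾ (f zero)))
      after : (champ ≡ just a ⊎ ∃ λ i → runᴾ (f i) ≡ just a) →
              (champ′ ≡ just a ⊎ ∃ λ i → runᴾ (f (suc i)) ≡ just a)
      after (inj₁ e)           = inj₁ (play-dominant cmp dom champ _ (inj₁ e))
      after (inj₂ (zero , e))  = inj₁ (play-dominant cmp dom champ _ (inj₂ e))
      after (inj₂ (suc i , e)) = inj₂ (i , e)

    cost-tournament-≤ : ∀ {X B₁ B₂} (cmp : X → X → Prog Q A X) champ k f →
      (∀ i → costᴾ (f i) ≤ B₁) → (∀ c d → costᴾ (cmp c d) ≤ B₂) →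
      costᴾ (tournamentᴾ cmp champ k f) ≤ k * (B₁ + B₂)
    cost-tournament-≤ cmp champ zero    f c₁ c₂ = z≤n
    cost-tournament-≤ {B₁ = B₁} {B₂} cmp champ (suc k) f c₁ c₂ =
      ≤-trans (cost-bind-≤ (f zero) _ (c₁ zero) λ d →
                cost-bind-≤ (playᴾ cmp champ d) _ (cost-play champ d) λ champ′ →
                  cost-tournament-≤ cmp champ′ k _ (λ i → c₁ (suc i)) c₂)
              (≤-reflexive (sym (+-assoc B₁ B₂ (k * (B₁ + B₂)))))
      where
      cost-play : ∀ c d → costᴾ (playᴾ cmp c d) ≤ B₂
      cost-play nothing  d        = z≤n
      cost-play (just c) nothing  = z≤n
      cost-play (just c) (just d) = ≤-trans (≤-reflexive (cost-map just (cmp c d))) (c₂ c d)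

    toDTree-decides : ∀ {B} p → Decides p B →
      (run (toDTree p) x ≡ true → B) × (B → run (toDTree p) x ≡ true)
    toDTree-decides p dp =
      (λ e → reflects-sound dp (trans (sym (run-toDTree p)) e)) ,
      (λ b → trans (run-toDTree p) (det dp (ofʸ b)))
      where
      run-toDTree : ∀ p → run (toDTree p) x ≡ runᴾ p
      run-toDTree (ret b)   = refl
      run-toDTree (ask q f) = run-toDTree (f (x q))

    cost-toDTree : ∀ p → cost (toDTree p) x ≡ costᴾ p
    cost-toDTree (ret b)   = refl
    cost-toDTree (ask q f) = cong suc (cost-toDTree (f (x q)))

module Algorithm (n m : ℕ) where

  Program : Set → Set
  Program = Prog (Cell n m) (Sym n m)

  _≟ᶜ_ : DecidableEquality (Cell n m)
  _≟ᶜ_ = Product.≡-dec _≟ᶠ_ _≟ᶠ_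

  _≟ᵖ_ : DecidableEquality (Ptr n m)
  _≟ᵖ_ = Maybe.≡-dec _≟ᶜ_

  _≟ˢ_ : DecidableEquality (Sym n m)
  _≟ˢ_ = Product.≡-dec Bool._≟_ (Product.≡-dec _≟ᵖ_ (Product.≡-dec _≟ᵖ_ _≟ᵖ_))

  pointer : Dir → Sym n m → Ptr n m
  pointer L = lpoint
  pointer R = rpoint

  followᴾ : Cell n m → List Dir → Program (Maybe (Cell n m))
  followᴾ c []      = ret (just c)
  followᴾ c (d ∷ p) = ask c λ s → maybe′ (λ c′ → followᴾ c′ p) (ret nothing) (pointer d s)

  endpointᴾ : Cell n m → Fin m → Program (Maybe (Cell n m))
  endpointᴾ a j′ = maybe′ (followᴾ a) (ret nothing) (path m j′)

  zeroCellᴾ : Fin m → Cell n m → Program Bool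
  zeroCellᴾ j′ ℓ = checkᴾ ℓ λ s → (col ℓ ≟ᶠ j′) ×-dec (val s Bool.≟ false)

  zeroEndᴾ : Cell n m → Fin m → Program Bool
  zeroEndᴾ c j′ = whenJustᴾ (endpointᴾ c j′) (zeroCellᴾ j′)

  pointsBackᴾ : Cell n m → Cell n m → Program Bool
  pointsBackᴾ a ℓ = checkᴾ ℓ λ s → bpoint s ≟ᵖ just a

  nonBlankᴾ : Cell n m → Program Bool
  nonBlankᴾ c = checkᴾ c λ s → ¬? (s ≟ˢ blank)

  -- evidence that c rather than d may be the anchor: within a column the
  -- anchor is the only non-blank cell, across columns the anchor's path to
  -- col d ends at a 0, which cannot happen inside the all-ones column
  witnessᴾ : Cell n m → Cell n m → Program Bool
  witnessᴾ c d = if does (col c ≟ᶠ col d) then nonBlankᴾ c else zeroEndᴾ c (col d)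

  compareᴾ : Cell n m → Cell n m → Program (Cell n m)
  compareᴾ c d = mapᴾ (λ b → if b then c else d) (witnessᴾ c d)

  candidateᴾ : Fin m → Fin n → Program (Maybe (Cell n m))
  candidateᴾ j i = ask (i , j) λ s → ret (bpoint s)

  columnCellᴾ : Cell n m → Fin n → Program Bool
  columnCellᴾ a i = checkᴾ (i , col a) λ s →
    (val s Bool.≟ true) ×-dec (((i , col a) ≟ᶜ a) ⊎-dec (s ≟ˢ blank))

  cond3ᴾ : Cell n m → Fin m → Program Bool
  cond3ᴾ a j′ = decideᴾ (¬? (j′ ≟ᶠ col a)) ⇒ᴾ zeroEndᴾ a j′

  goodᴾ : Cell n m → Fin m → Program Bool
  goodᴾ a j′ = decideᴾ (¬? (j′ ≟ᶠ col a)) &&ᴾ whenJustᴾ (endpointᴾ a j′) (pointsBackᴾ a)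

  anchorᴾ : Cell n m → Program Bool
  anchorᴾ a = allᴾ n (columnCellᴾ a) &&ᴾ nonBlankᴾ a &&ᴾ allᴾ m (cond3ᴾ a)

  verifyᴾ : ℕ → Fin m → Cell n m → Program Bool
  verifyᴾ h j a = anchorᴾ a &&ᴾ countIsᴾ h m (goodᴾ a) &&ᴾ goodᴾ a j

  championᴾ : Fin m → Program (Maybe (Cell n m))
  championᴾ j = tournamentᴾ compareᴾ nothing n (candidateᴾ j)

  algorithm : ℕ → Fin m → Program Bool
  algorithm h j = whenJustᴾ (championᴾ j) (verifyᴾ h j)

module Correctness {n m : ℕ} (x : Input n m) where
  open Algorithm n m
  open Semantics x

  ZeroEnd : Cell n m → Fin m → Set
  ZeroEnd c j′ = Σ (Cell n m) λ ℓ → endpoint x c j′ ≡ just ℓ × col ℓ ≡ j′ × val (x ℓ) ≡ false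

  ColumnCell : Cell n m → Fin n → Set
  ColumnCell a i = val (x (i , col a)) ≡ true × ((i , col a) ≡ a ⊎ x (i , col a) ≡ blank)

  UniqueInColumn : Cell n m → Set
  UniqueInColumn a = ∀ a′ → col a′ ≡ col a → x a′ ≢ blank → a′ ≡ a

  ColumnOK : Cell n m → Set
  ColumnOK a = AllOnes x (col a) × UniqueInColumn a

  -- a satisfies conditions (2) and (3) with b = col a, and col a is all
  -- ones (the uniqueness in (1) then follows, see allOnes-unique)
  Anchor : Cell n m → Set
  Anchor a = ColumnOK a × x a ≢ blank × Cond3 x (col a) a

  Verified : ℕ → Fin m → Cell n m → Set
  Verified h j a = Anchor a × Cond4 x (col a) a h × InG x (col a) a j

  allOnes-cell : ∀ {b ℓ} → AllOnes x b → col ℓ ≡ b → val (x ℓ) ≡ true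
  allOnes-cell ones refl = ones _

  -- condition (3) forces uniqueness in condition (1): every other column has a 0
  allOnes-unique : ∀ {b a b′} → Cond3 x b a → AllOnes x b′ → b′ ≡ b
  allOnes-unique {b} {b′ = b′} c3 ones with b′ ≟ᶠ b
  ... | yes e = e
  ... | no ne with c3 b′ ne
  ...   | ℓ , _ , col≡ , val0 = ⊥-elim (Bool.not-¬ (allOnes-cell ones col≡) val0)

  columnCells→ok : ∀ a → (∀ i → ColumnCell a i) → ColumnOK a
  columnCells→ok a cells = (λ i → proj₁ (cells i)) , unique
    where
    unique : UniqueInColumn a
    unique (i , _) refl nb with proj₂ (cells i)
    ... | inj₁ e     = e
    ... | inj₂ blank = ⊥-elim (nb blank)

  ok→columnCells : ∀ a → ColumnOK a → ∀ i → ColumnCell a i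
  ok→columnCells a (ones , unique) i = ones i , cell
    where
    cell : (i , col a) ≡ a ⊎ x (i , col a) ≡ blank
    cell with x (i , col a) ≟ˢ blank
    ... | yes b = inj₂ b
    ... | no nb = inj₁ (unique (i , col a) refl nb)

  run-follow : ∀ c p → runᴾ (followᴾ c p) ≡ follow x c p
  run-followFrom : ∀ mc p →
    runᴾ (maybe′ (λ c′ → followᴾ c′ p) (ret nothing) mc) ≡ (mc >>= λ c′ → follow x c′ p)
  run-follow c []      = refl
  run-follow c (L ∷ p) = run-followFrom (lpoint (x c)) p
  run-follow c (R ∷ p) = run-followFrom (rpoint (x c)) p
  run-followFrom nothing   p = refl
  run-followFrom (just c′) p = run-follow c′ p

  run-endpoint : ∀ c j′ → runᴾ (endpointᴾ c j′) ≡ endpoint x c j′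
  run-endpoint c j′ with path m j′
  ... | nothing = refl
  ... | just p  = run-follow c p

  atEnd-decides : ∀ {B : Cell n m → Set} c j′ (test : Cell n m → Program Bool) →
    (∀ ℓ → Decides (test ℓ) (B ℓ)) →
    Decides (whenJustᴾ (endpointᴾ c j′) test) (Σ (Cell n m) λ ℓ → endpoint x c j′ ≡ just ℓ × B ℓ)
  atEnd-decides {B} c j′ test dtest = subst Decides-at-end (run-endpoint c j′)
    (whenJust-decides (endpointᴾ c j′) test dtest)
    where
    Decides-at-end : Maybe (Cell n m) → Set
    Decides-at-end e = Decides (whenJustᴾ (endpointᴾ c j′) test) (Σ (Cell n m) λ ℓ → e ≡ just ℓ × B ℓ)

  zeroEnd-decides : ∀ c j′ → Decides (zeroEndᴾ c j′) (ZeroEnd c j′)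
  zeroEnd-decides c j′ = atEnd-decides c j′ (zeroCellᴾ j′) λ ℓ →
    proof ((col ℓ ≟ᶠ j′) ×-dec (val (x ℓ) Bool.≟ false))

  nonBlank-decides : ∀ c → Decides (nonBlankᴾ c) (x c ≢ blank)
  nonBlank-decides c = proof (¬? (x c ≟ˢ blank))

  cond3-decides : ∀ a j′ → Decides (cond3ᴾ a j′) (j′ ≢ col a → ZeroEnd a j′)
  cond3-decides a j′ = ⇒-decides (decideᴾ (¬? (j′ ≟ᶠ col a))) (zeroEndᴾ a j′)
    (proof (¬? (j′ ≟ᶠ col a))) (zeroEnd-decides a j′)

  good-decides : ∀ a j′ → Decides (goodᴾ a j′) (InG x (col a) a j′)
  good-decides a j′ = &&-decides (decideᴾ (¬? (j′ ≟ᶠ col a))) (whenJustᴾ (endpointᴾ a j′) (pointsBackᴾ a))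
    (proof (¬? (j′ ≟ᶠ col a)))
    (atEnd-decides a j′ (pointsBackᴾ a) λ ℓ → proof (bpoint (x ℓ) ≟ᵖ just a))

  anchor-decides : ∀ a → Decides (anchorᴾ a) (Anchor a)
  anchor-decides a = &&-decides (allᴾ n (columnCellᴾ a)) (nonBlankᴾ a &&ᴾ allᴾ m (cond3ᴾ a))
    (reflects-map (columnCells→ok a) (ok→columnCells a)
      (all-decides (columnCellᴾ a) λ i →
        proof ((val (x (i , col a)) Bool.≟ true) ×-dec (((i , col a) ≟ᶜ a) ⊎-dec (x (i , col a) ≟ˢ blank)))))
    (&&-decides (nonBlankᴾ a) (allᴾ m (cond3ᴾ a))
      (nonBlank-decides a) (all-decides (cond3ᴾ a) (cond3-decides a)))

  verify-decides : ∀ h j a → Decides (verifyᴾ h j a) (Verified h j a)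
  verify-decides h j a = &&-decides (anchorᴾ a) (countIsᴾ h m (goodᴾ a) &&ᴾ goodᴾ a j) (anchor-decides a)
    (&&-decides (countIsᴾ h m (goodᴾ a)) (goodᴾ a j)
      (countIs-decides h (goodᴾ a) (good-decides a)) (good-decides a j))

  witness-wins : ∀ {c} d → Anchor c → runᴾ (witnessᴾ c d) ≡ true
  witness-wins {c} d (_ , nb , c3) with col c ≟ᶠ col d
  ... | yes _ = det (nonBlank-decides c) (ofʸ nb)
  ... | no ne = det (zeroEnd-decides c (col d)) (ofʸ (c3 (col d) (λ e → ne (sym e))))

  witness-loses : ∀ c {d} → Anchor d → c ≢ d → runᴾ (witnessᴾ c d) ≡ false
  witness-loses c {d} ((ones , unique) , _) c≢d with col c ≟ᶠ col d
  ... | yes same = det (nonBlank-decides c) (ofⁿ λ nb → c≢d (unique c same nb))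
  ... | no _     = det (zeroEnd-decides c (col d))
                       (ofⁿ λ { (ℓ , _ , col≡ , val0) → Bool.not-¬ (allOnes-cell ones col≡) val0 })

  -- The anchor is dominant for compareᴾ (for c = a either outcome is a).
  compare-dominant : ∀ {a} → Anchor a → Dominant compareᴾ a
  compare-dominant {a} anchor = beats , beaten-by
    where
    beats : ∀ d → runᴾ (compareᴾ a d) ≡ a
    beats d = trans (run-map _ (witnessᴾ a d)) (cong (λ b → if b then a else d) (witness-wins d anchor))
    beaten-by : ∀ c → runᴾ (compareᴾ c a) ≡ a
    beaten-by c with c ≟ᶜ a
    ... | yes refl = trans (run-map _ (witnessᴾ c c)) (Bool.if-eta (runᴾ (witnessᴾ c c)))
    ... | no c≢a   = trans (run-map _ (witnessᴾ c a))
                           (cong (λ b → if b then c else a) (witness-loses c anchor c≢a))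

  -- If column j is good, the row of ℓ_j in column j points back to the anchor,
  -- as ℓ_j lies in column j by condition (3).
  candidate-proposes : ∀ {h j a} → Verified h j a → ∃ λ i → runᴾ (candidateᴾ j i) ≡ just a
  candidate-proposes {j = j} ((_ , _ , c3) , _ , j≢b , ℓ , end≡ , back) with c3 j j≢b
  ... | _ , end≡′ , col≡ , _ = proj₁ ℓ , trans (cong (λ k → bpoint (x (proj₁ ℓ , k))) (sym col≡ℓ)) back
    where
    col≡ℓ : col ℓ ≡ j
    col≡ℓ = trans (cong col (just-injective (trans (sym end≡) end≡′))) col≡

  verified→positive : ∀ {h j a} → Verified h j a → PositiveGood h x j
  verified→positive {a = a} (((ones , unique) , nb , c3) , card , good) =
    col a , a , (ones , λ _ → allOnes-unique c3) , (refl , nb , unique) , c3 , card , good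

  positive→verified : ∀ {h j} → PositiveGood h x j → Σ (Cell n m) (Verified h j)
  positive→verified (_ , a , (ones , _) , (refl , nb , unique) , c3 , card , good) =
    a , ((ones , unique) , nb , c3) , card , good

  -- On a positive input the anchor is among the candidates and wins the
  -- tournament; conversely any verified champion certifies PositiveGood.
  algorithm-decides : ∀ h j → Decides (algorithm h j) (PositiveGood h x j)
  algorithm-decides h j = reflects-map
    (λ { (_ , _ , verified) → verified→positive verified })
    (λ positive → let (a , verified) = positive→verified positive in
      a , tournament-dominant compareᴾ (compare-dominant (proj₁ verified)) nothing n (candidateᴾ j)
            (inj₂ (candidate-proposes verified)) ,
      verified)
    (whenJust-decides (championᴾ j) (verifyᴾ h j) (verify-decides h j))

module Complexity {n m : ℕ} (x : Input n m) where
  open Algorithm n m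
  open Semantics x

  -- bound on the length of every path T(j′)
  ℒ : ℕ
  ℒ = suc ⌊log₂ (n + m) ⌋

  cost-follow : ∀ c p → costᴾ (followᴾ c p) ≤ length p
  cost-followFrom : ∀ mc p → costᴾ (maybe′ (λ c′ → followᴾ c′ p) (ret nothing) mc) ≤ length p
  cost-follow c []      = z≤n
  cost-follow c (d ∷ p) = s≤s (cost-followFrom (pointer d (x c)) p)
  cost-followFrom nothing   p = z≤n
  cost-followFrom (just c′) p = cost-follow c′ p

  cost-endpoint : ∀ c j′ → costᴾ (endpointᴾ c j′) ≤ ℒ
  cost-endpoint c j′ with path m j′ in e
  ... | nothing = z≤n
  ... | just p  = ≤-trans (cost-follow c p)
                   (≤-trans (path-length m j′ e) (s≤s (⌊log₂⌋-mono-≤ (m≤n+m m n))))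

  cost-atEnd : ∀ c j′ test → (∀ ℓ → costᴾ (test ℓ) ≤ 1) → costᴾ (whenJustᴾ (endpointᴾ c j′) test) ≤ ℒ + 1
  cost-atEnd c j′ test c₁ = cost-whenJust-≤ (endpointᴾ c j′) test (cost-endpoint c j′) c₁

  cost-zeroEnd : ∀ c j′ → costᴾ (zeroEndᴾ c j′) ≤ ℒ + 1
  cost-zeroEnd c j′ = cost-atEnd c j′ (zeroCellᴾ j′) (λ ℓ → ≤-refl)

  cost-compare : ∀ c d → costᴾ (compareᴾ c d) ≤ ℒ + 1
  cost-compare c d = ≤-trans (≤-reflexive (cost-map _ (witnessᴾ c d))) witness
    where
    witness : costᴾ (witnessᴾ c d) ≤ ℒ + 1
    witness with col c ≟ᶠ col d
    ... | yes _ = m≤n+m 1 ℒ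
    ... | no _  = cost-zeroEnd c (col d)

  -- n back-pointer reads and at most n comparisons
  cost-champion : ∀ j → costᴾ (championᴾ j) ≤ n * (1 + (ℒ + 1))
  cost-champion j = cost-tournament-≤ compareᴾ nothing n (candidateᴾ j) (λ i → ≤-refl) cost-compare

  cost-cond3 : ∀ a j′ → costᴾ (cond3ᴾ a j′) ≤ ℒ + 1
  cost-cond3 a j′ = cost-zipWith-≤ {B₁ = 0} (λ b c → not b ∨ c)
    (decideᴾ (¬? (j′ ≟ᶠ col a))) (zeroEndᴾ a j′) z≤n (cost-zeroEnd a j′)

  cost-good : ∀ a j′ → costᴾ (goodᴾ a j′) ≤ ℒ + 1
  cost-good a j′ = cost-zipWith-≤ {B₁ = 0} _∧_
    (decideᴾ (¬? (j′ ≟ᶠ col a))) (whenJustᴾ (endpointᴾ a j′) (pointsBackᴾ a))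
    z≤n (cost-atEnd a j′ (pointsBackᴾ a) (λ ℓ → ≤-refl))

  -- column check, anchor check, condition (3), counting G, and j ∈ G
  VerifyBound : ℕ
  VerifyBound = (n * 1 + (1 + m * (ℒ + 1))) + (m * (ℒ + 1) + (ℒ + 1))

  cost-verify : ∀ h j a → costᴾ (verifyᴾ h j a) ≤ VerifyBound
  cost-verify h j a =
    cost-zipWith-≤ _∧_ (anchorᴾ a) (countIsᴾ h m (goodᴾ a) &&ᴾ goodᴾ a j)
      (cost-zipWith-≤ _∧_ (allᴾ n (columnCellᴾ a)) (nonBlankᴾ a &&ᴾ allᴾ m (cond3ᴾ a))
        (cost-all-≤ (columnCellᴾ a) (λ i → ≤-refl))
        (cost-zipWith-≤ _∧_ (nonBlankᴾ a) (allᴾ m (cond3ᴾ a)) ≤-refl (cost-all-≤ (cond3ᴾ a) (cost-cond3 a))))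
      (cost-zipWith-≤ _∧_ (countIsᴾ h m (goodᴾ a)) (goodᴾ a j)
        (≤-trans (≤-reflexive (cost-map _ (countᴾ m (goodᴾ a)))) (cost-count-≤ (goodᴾ a) (cost-good a)))
        (cost-good a j))

  cost-algorithm : ∀ h j → costᴾ (algorithm h j) ≤ n * (1 + (ℒ + 1)) + VerifyBound
  cost-algorithm h j = cost-whenJust-≤ (championᴾ j) (verifyᴾ h j) (cost-champion j) (cost-verify h j)

-- The explicit query bound plus a polynomial with nonnegative coefficients
-- equals 10 (n + m) L, with n = 1 + n′ and L = 1 + l.
bound-with-slack : ∀ n′ m l →
  (1 + n′) * (1 + ((1 + l) + 1))
    + (((1 + n′) * 1 + (1 + m * ((1 + l) + 1))) + (m * ((1 + l) + 1) + ((1 + l) + 1)))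
    + (3 + 8 * l + 6 * n′ + 9 * n′ * l + 6 * m + 8 * m * l)
  ≡ 10 * ((1 + n′) + m) * ((1 + l) * 1)
bound-with-slack = solve-∀

cost-arithmetic : ∀ n′ m l →
  suc n′ * (1 + (suc l + 1)) + ((suc n′ * 1 + (1 + m * (suc l + 1))) + (m * (suc l + 1) + (suc l + 1)))
    ≤ 10 * (suc n′ + m) * suc l ^ 1
cost-arithmetic n′ m l = ≤-trans (m≤m+n _ (3 + 8 * l + 6 * n′ + 9 * n′ * l + 6 * m + 8 * m * l))
                                 (≤-reflexive (bound-with-slack n′ m l))

queryTree : (n m h : ℕ) → Fin m → DTree (Cell n m) (Sym n m)
queryTree n m h j = toDTree (Algorithm.algorithm n m h j)

queryTree-correct : ∀ {n m} h j (x : Input n m) →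
  (run (queryTree n m h j) x ≡ true → PositiveGood h x j) ×
  (PositiveGood h x j → run (queryTree n m h j) x ≡ true)
queryTree-correct h j x =
  Semantics.toDTree-decides x (Algorithm.algorithm _ _ h j) (Correctness.algorithm-decides x h j)

queryTree-cost : ∀ n′ m h j (x : Input (suc n′) m) →
  cost (queryTree (suc n′) m h j) x ≤ 10 * (suc n′ + m) * (suc ⌊log₂ (suc n′ + m) ⌋) ^ 1
queryTree-cost n′ m h j x =
  ≤-trans (≤-reflexive (Semantics.cost-toDTree x (Algorithm.algorithm (suc n′) m h j)))
    (≤-trans (Complexity.cost-algorithm x h j) (cost-arithmetic n′ m ⌊log₂ (suc n′ + m) ⌋))

lemma13 : Σ ℕ λ c → Σ ℕ λ k →
    (n m h : ℕ) → NonZero n → NonZero m → m ≡ 2 * h →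
    Σ (Fin m → DTree (Cell n m) (Sym n m)) λ alg →
      (j : Fin m) (x : Input n m) →
        ((run (alg j) x ≡ true → PositiveGood h x j)
         × (PositiveGood h x j → run (alg j) x ≡ true))
        × cost (alg j) x ≤ c * (n + m) * (suc ⌊log₂ (n + m) ⌋) ^ k
lemma13 = 10 , 1 , λ { (suc n′) m h _ _ _ →
  queryTree (suc n′) m h , λ j x → queryTree-correct h j x , queryTree-cost n′ m h j x }
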